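{- Let $\mathcal{N}$ be a finite undirected graph and let $\mathcal{I}=\mathcal{N}.\omega$ and $\mathcal{I}'=\mathcal{N}.\omega'$ be two irreducible subgraphs obtained from $\mathcal{N}$ by the reduction process (possibly with different orders of processing nodes). Then $\mathcal{I}\cong\mathcal{I}'$, i.e. there is a bijection $i$ between their node sets such that $(i(x),i(y))$ is an edge of $\mathcal{I}'$ if and only if $(x,y)$ is an edge of $\mathcal{I}$.
   Context: For a set $Y$ of nodes of a graph, $Y.\eta=\{z\notin Y : \exists y\in Y,\ (y,z)\text{ is an edge}\}$, $Y.\rho=Y\cup Y.\eta$, and the neighborhood closure is $Y.\varphi=\{z\in Y.\rho:\{z\}.\rho\subseteq Y.\rho\}$. A graph is irreducible if every singleton node set $\{y\}$ satisfies $\{y\}.\varphi=\{y\}$. A node $z$ is subsumed by a node $y\neq z$ if $z\in\{y\}.\eta$ and $\{z\}.\eta\subseteq\{y\}.\rho$. The reduction process (denoted $\omega$, $\omega'$ for different runs) repeatedly selects a node $z$ subsumed by some node $y$ in the current graph and deletes $z$ with its incident edges, iterating until no node is subsumed by another; the order in which nodes are encountered may differ between runs. -}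

module Defs where

open import Data.Nat using (ℕ)
open import Data.Fin using (Fin)
open import Data.Fin.Subset using (Subset; _∈_; _─_; ⁅_⁆; ⊤)
open import Data.Product using (Σ; ∃; _×_; _,_)
open import Data.Sum using (_⊎_)
open import Relation.Nullary using (¬_)
open import Relation.Binary.PropositionalEquality using (_≡_)
open import Relation.Binary.Construct.Closure.ReflexiveTransitive using (Star)
open import Function.Bundles using (_↔_)

record Graph (n : ℕ) : Set₁ where
  field
    Adj   : Fin n → Fin n → Set
    sym   : ∀ {x y} → Adj x y → Adj y x
    irrfl : ∀ {x} → ¬ Adj x x
open Graph public

module _ {n : ℕ} (G : Graph n) where

  -- In the current graph (the subgraph induced by the set S of remaining
  -- nodes), z is subsumed by y ≠ z:  z ∈ {y}.η  and  {z}.η ⊆ {y}.ρ.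
  SubsumedBy : Subset n → Fin n → Fin n → Set
  SubsumedBy S z y =
    y ∈ S × z ∈ S × ¬ (z ≡ y) × Adj G y z ×
    (∀ w → w ∈ S → ¬ (w ≡ z) → Adj G z w → (w ≡ y ⊎ Adj G y w))

  Subsumed : Subset n → Fin n → Set
  Subsumed S z = ∃ λ y → SubsumedBy S z y

  data Step : Subset n → Subset n → Set where
    delete : ∀ {S} z → Subsumed S z → Step S (S ─ ⁅ z ⁆)

  Terminal : Subset n → Set
  Terminal S = ∀ z → ¬ Subsumed S z

  ReductionResult : Subset n → Set
  ReductionResult S = Star Step ⊤ S × Terminal S

  Node : Subset n → Set
  Node S = Σ (Fin n) (λ x → x ∈ S)

  Isomorphic : Subset n → Subset n → Set
  Isomorphic S S′ =
    Σ (Node S ↔ Node S′) λ i →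
      ∀ (x y : Node S) →
        let open Function.Bundles.Inverse i
            open Σ
        in (Adj G (proj₁ x) (proj₁ y) → Adj G (proj₁ (to x)) (proj₁ (to y)))
         × (Adj G (proj₁ (to x)) (proj₁ (to y)) → Adj G (proj₁ x) (proj₁ y))

-- Deleting a node z subsumed by y is a retraction of the current graph onto
-- the remaining one (send z to y); it preserves "equal or adjacent", since the
-- closed neighbourhood of z lies inside that of y. Composing along a run gives
-- retractions r : N → I and r′ : N → I′. To see that r ∘ r′ is the identity on
-- I, follow the run towards I′ and keep the invariant that the current image h
-- of I satisfies r ∘ h = id on I: when h x is deleted in favour of y, the
-- closed neighbourhood of x in I lies inside that of r y, so irreducibility of I
-- forces r y = x. By symmetry r and r′ restrict to mutually inverse maps between
-- I and I′, and both preserve adjacency.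
module Submission where

open import Defs
open import Data.Nat using (ℕ)
open import Data.Fin using (Fin; _≟_)
open import Data.Fin.Subset using (Subset; _∈_; _∉_; _⊆_; _─_; ⁅_⁆; ⊤; outside)
open import Data.Fin.Subset.Properties using (∈⊤; ⊆⊤; x∈p∧x∉q⇒x∈p─q; p─q⊆p; x≢y⇒x∉⁅y⁆; x∈⁅x⁆)
open import Data.Vec.Base using (_∷_; here; there)
open import Data.Vec.Properties.WithK using ([]=-irrelevant)
open import Data.Product using (_,_)
open import Data.Sum using (_⊎_; inj₁; inj₂)
open import Function.Base using (id; _∘_)
open import Function.Bundles using (mk↔ₛ′)
open import Relation.Nullary using (yes; no; contradiction)
open import Relation.Binary.PropositionalEquality
  using (_≡_; _≢_; refl; cong; subst; subst₂; trans) renaming (sym to ≡-sym)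
open import Relation.Binary.Construct.Closure.Reflexive using (ReflClosure; refl; [_])
import Relation.Binary.Construct.Closure.Reflexive.Properties as ReflClosure
open import Relation.Binary.Construct.Closure.ReflexiveTransitive using (Star; ε; _◅_)

x∈p─q⇒x∉q : ∀ {n} {p q : Subset n} {x : Fin n} → x ∈ p ─ q → x ∉ q
x∈p─q⇒x∉q {p = _ ∷ _} {outside ∷ _} here       ()
x∈p─q⇒x∉q {p = _ ∷ _} {_ ∷ _}       (there x∈) (there x∈q) = x∈p─q⇒x∉q x∈ x∈q

module _ {n : ℕ} (G : Graph n) where

  Adj⁼ : Fin n → Fin n → Set
  Adj⁼ = ReflClosure (Adj G)

  Adj⁼-sym : ∀ {x y} → Adj⁼ x y → Adj⁼ y x
  Adj⁼-sym = ReflClosure.sym (Graph.sym G)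

  Adj⁼⇒≡⊎Adj : ∀ {x y} → Adj⁼ x y → y ≡ x ⊎ Adj G x y
  Adj⁼⇒≡⊎Adj refl  = inj₁ refl
  Adj⁼⇒≡⊎Adj [ a ] = inj₂ a

  Adj⇒≢ : ∀ {x y} → Adj G x y → x ≢ y
  Adj⇒≢ a refl = irrfl G a

  ≢∧Adj⁼⇒Adj : ∀ {x y} → x ≢ y → Adj⁼ x y → Adj G x y
  ≢∧Adj⁼⇒Adj x≢x refl  = contradiction refl x≢x
  ≢∧Adj⁼⇒Adj _   [ a ] = a

  Dominates : Subset n → Fin n → Fin n → Set
  Dominates D y x = ∀ {w} → w ∈ D → Adj⁼ x w → Adj⁼ y w

  subsumed⇒dominated : ∀ {S z y} → SubsumedBy G S z y → Dominates S y z
  subsumed⇒dominated (_ , _ , _ , y~z , _) _ refl = [ y~z ]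
  subsumed⇒dominated (_ , _ , _ , _ , z↝) {w} w∈S [ z~w ]
    with z↝ w w∈S (Adj⇒≢ z~w ∘ ≡-sym) z~w
  ... | inj₁ refl = refl
  ... | inj₂ y~w  = [ y~w ]

  terminal∧dominated⇒≡ : ∀ {S x y} → Terminal G S → x ∈ S → y ∈ S →
                         Dominates S y x → y ≡ x
  terminal∧dominated⇒≡ {S} {x} {y} S-terminal x∈S y∈S y≥x with y ≟ x
  ... | yes y≡x = y≡x
  ... | no  y≢x = contradiction
    (y , y∈S , x∈S , y≢x ∘ ≡-sym , ≢∧Adj⁼⇒Adj y≢x (y≥x x∈S refl) ,
     λ w w∈S _ x~w → Adj⁼⇒≡⊎Adj (y≥x w∈S [ x~w ]))
    (S-terminal x)

  record Hom (D E : Subset n) (h : Fin n → Fin n) : Set where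
    field
      maps      : ∀ {x} → x ∈ D → h x ∈ E
      preserves : ∀ {x y} → x ∈ D → y ∈ D → Adj⁼ x y → Adj⁼ (h x) (h y)
  open Hom

  Hom-id : ∀ {D E} → D ⊆ E → Hom D E id
  Hom-id D⊆E = record { maps = D⊆E ; preserves = λ _ _ → id }

  Hom-∘ : ∀ {D E F f g} → Hom E F g → Hom D E f → Hom D F (g ∘ f)
  Hom-∘ g f = record
    { maps      = maps g ∘ maps f
    ; preserves = λ x∈ y∈ → preserves g (maps f x∈) (maps f y∈) ∘ preserves f x∈ y∈
    }

  Hom-⊆ : ∀ {D D′ E h} → D′ ⊆ D → Hom D E h → Hom D′ E h
  Hom-⊆ D′⊆D h = record
    { maps = maps h ∘ D′⊆D ; preserves = λ x∈ y∈ → preserves h (D′⊆D x∈) (D′⊆D y∈) }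

  Hom⇒Adj-preserved : ∀ {D E h x y} → Hom D E h → x ∈ D → y ∈ D →
                      (h x ≡ h y → x ≡ y) → Adj G x y → Adj G (h x) (h y)
  Hom⇒Adj-preserved h x∈ y∈ inj x~y =
    ≢∧Adj⁼⇒Adj (Adj⇒≢ x~y ∘ inj) (preserves h x∈ y∈ [ x~y ])

  retract : ∀ {S S′} → Step G S S′ → Fin n → Fin n
  retract (delete z (y , _)) x with x ≟ z
  ... | yes _ = y
  ... | no  _ = x

  retract-Hom : ∀ {S S′} (s : Step G S S′) → Hom S S′ (retract s)
  retract-Hom {S} s@(delete z (y , z⊑y@(y∈S , _ , z≢y , _))) = record
    { maps = maps′ ; preserves = preserves′ }
    where
    maps′ : ∀ {x} → x ∈ S → retract s x ∈ S ─ ⁅ z ⁆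
    maps′ {x} x∈S with x ≟ z
    ... | yes _   = x∈p∧x∉q⇒x∈p─q y∈S (x≢y⇒x∉⁅y⁆ (z≢y ∘ ≡-sym))
    ... | no  x≢z = x∈p∧x∉q⇒x∈p─q x∈S (x≢y⇒x∉⁅y⁆ x≢z)
    preserves′ : ∀ {a b} → a ∈ S → b ∈ S → Adj⁼ a b → Adj⁼ (retract s a) (retract s b)
    preserves′ {a} {b} a∈S b∈S a~b with a ≟ z | b ≟ z
    ... | yes _    | yes _    = refl
    ... | yes refl | no  _    = subsumed⇒dominated z⊑y b∈S a~b
    ... | no  _    | yes refl = Adj⁼-sym (subsumed⇒dominated z⊑y a∈S (Adj⁼-sym a~b))
    ... | no  _    | no  _    = a~b

  retract-fixes : ∀ {S S′} (s : Step G S S′) {x} → x ∈ S′ → retract s x ≡ x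
  retract-fixes (delete z _) {x} x∈S′ with x ≟ z
  ... | yes refl = contradiction (x∈⁅x⁆ x) (x∈p─q⇒x∉q x∈S′)
  ... | no  _    = refl

  Star⇒⊇ : ∀ {S S′} → Star (Step G) S S′ → S′ ⊆ S
  Star⇒⊇ ε                        = id
  Star⇒⊇ (delete {S} z _ ◅ steps) = p─q⊆p S ⁅ z ⁆ ∘ Star⇒⊇ steps

  retract⋆ : ∀ {S S′} → Star (Step G) S S′ → Fin n → Fin n
  retract⋆ ε            = id
  retract⋆ (s ◅ steps) = retract⋆ steps ∘ retract s

  retract⋆-Hom : ∀ {S S′} (steps : Star (Step G) S S′) → Hom S S′ (retract⋆ steps)
  retract⋆-Hom ε            = Hom-id id
  retract⋆-Hom (s ◅ steps) = Hom-∘ (retract⋆-Hom steps) (retract-Hom s)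

  retract⋆-fixes : ∀ {S S′} (steps : Star (Step G) S S′) {x} → x ∈ S′ → retract⋆ steps x ≡ x
  retract⋆-fixes ε            _    = refl
  retract⋆-fixes (s ◅ steps) x∈S′ = trans
    (cong (retract⋆ steps) (retract-fixes s (Star⇒⊇ steps x∈S′)))
    (retract⋆-fixes steps x∈S′)

  InverseOn : Subset n → (Fin n → Fin n) → (Fin n → Fin n) → Set
  InverseOn D r h = ∀ {x} → x ∈ D → r (h x) ≡ x

  module _ {I r} (I-terminal : Terminal G I) (r-Hom : Hom ⊤ I r) where

    retract-keeps-InverseOn : ∀ {S S′ h} (s : Step G S S′) → Hom I S h →
                              InverseOn I r h → InverseOn I r (retract s ∘ h)
    retract-keeps-InverseOn {h = h} (delete z (y , z⊑y)) h-Hom r∘h≡id {x} x∈I with h x ≟ z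
    ... | no  _   = r∘h≡id x∈I
    ... | yes h≡z = terminal∧dominated⇒≡ I-terminal x∈I (maps r-Hom ∈⊤) ry≥x
      where
      ry≥x : Dominates I (r y) x
      ry≥x {w} w∈I x~w = subst (Adj⁼ (r y)) (r∘h≡id w∈I)
        (preserves r-Hom ∈⊤ ∈⊤ (subsumed⇒dominated z⊑y (maps h-Hom w∈I)
          (subst (λ v → Adj⁼ v (h w)) h≡z (preserves h-Hom x∈I w∈I x~w))))

    retract⋆-keeps-InverseOn : ∀ {S S′ h} (steps : Star (Step G) S S′) → Hom I S h →
                               InverseOn I r h → InverseOn I r (retract⋆ steps ∘ h)
    retract⋆-keeps-InverseOn ε           _     r∘h≡id = r∘h≡id
    retract⋆-keeps-InverseOn (s ◅ steps) h-Hom r∘h≡id = retract⋆-keeps-InverseOn steps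
      (Hom-∘ (retract-Hom s) h-Hom) (retract-keeps-InverseOn s h-Hom r∘h≡id)

  retract⋆-inverse : ∀ {I I′} (run : Star (Step G) ⊤ I) (run′ : Star (Step G) ⊤ I′) →
                     Terminal G I → InverseOn I (retract⋆ run) (retract⋆ run′)
  retract⋆-inverse run run′ I-terminal = retract⋆-keeps-InverseOn I-terminal
    (retract⋆-Hom run) run′ (Hom-id ⊆⊤) (retract⋆-fixes run)

  Node-≡ : ∀ {S x y} {x∈ : x ∈ S} {y∈ : y ∈ S} → x ≡ y → _≡_ {A = Node G S} (x , x∈) (y , y∈)
  Node-≡ {x∈ = x∈} {y∈} refl = cong (_ ,_) ([]=-irrelevant x∈ y∈)

  inverse-Homs⇒Isomorphic : ∀ {I I′ f g} → Hom I I′ f → Hom I′ I g →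
                            InverseOn I g f → InverseOn I′ f g → Isomorphic G I I′
  inverse-Homs⇒Isomorphic {I} {I′} {f} {g} f-Hom g-Hom g∘f≡id f∘g≡id =
    mk↔ₛ′ to from (λ (_ , y∈) → Node-≡ (f∘g≡id y∈)) (λ (_ , x∈) → Node-≡ (g∘f≡id x∈)) ,
    λ (x , x∈) (y , y∈) → forth x∈ y∈ , back x∈ y∈
    where
    to : Node G I → Node G I′
    to (x , x∈) = f x , maps f-Hom x∈
    from : Node G I′ → Node G I
    from (y , y∈) = g y , maps g-Hom y∈
    cancel : ∀ {x y} → x ∈ I → y ∈ I → g (f x) ≡ g (f y) → x ≡ y
    cancel x∈ y∈ e = trans (≡-sym (g∘f≡id x∈)) (trans e (g∘f≡id y∈))
    forth : ∀ {x y} → x ∈ I → y ∈ I → Adj G x y → Adj G (f x) (f y)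
    forth x∈ y∈ = Hom⇒Adj-preserved f-Hom x∈ y∈ (cancel x∈ y∈ ∘ cong g)
    back : ∀ {x y} → x ∈ I → y ∈ I → Adj G (f x) (f y) → Adj G x y
    back x∈ y∈ = subst₂ (Adj G) (g∘f≡id x∈) (g∘f≡id y∈)
      ∘ Hom⇒Adj-preserved g-Hom (maps f-Hom x∈) (maps f-Hom y∈)
          (cong f ∘ cancel x∈ y∈)

proposition3 : ∀ {n : ℕ} (N : Graph n) (I I′ : Subset n) →
    ReductionResult N I → ReductionResult N I′ → Isomorphic N I I′
proposition3 N I I′ (run , I-terminal) (run′ , I′-terminal) =
  inverse-Homs⇒Isomorphic N
    (Hom-⊆ N ⊆⊤ (retract⋆-Hom N run′)) (Hom-⊆ N ⊆⊤ (retract⋆-Hom N run))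
    (retract⋆-inverse N run run′ I-terminal) (retract⋆-inverse N run′ run I′-terminal)
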